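{- Let $\Sigma$ be a monoidal signature and let $f : A \to B$ be a closed $\Sigma^{+}$-term. Then there exist $n \ge 1$ and closed $\Sigma^{+}$-terms $f_1, \ldots, f_n : A \to B$, none of which contains the join operator $+$, such that $f = f_1 + \ldots + f_n$ modulo the laws of a symmetric monoidal category, the $\mathbf{SLat}$-equations, and the distributivity law $\Lambda_{A,B,C}(g + h) = \Lambda_{A,B,C}(g) + \Lambda_{A,B,C}(h)$.
   Context: A monoidal signature $\Sigma = (\Sigma_O, \Sigma_M, t)$ consists of a set $\Sigma_O$ of basic types, a set $\Sigma_M$ of operations, and a typing $t : \Sigma_M \to \Sigma_O^* \times \Sigma_O^*$. Objects are built from $\Sigma_O$ and a unit $I$ using $\otimes$ and $\multimap$. Closed $\Sigma$-terms are generated by: operations $\phi : A \to B$ in $\Sigma_M$; identities $\mathrm{id}_A$ and symmetries $\sigma_{A,B} : A \otimes B \to B \otimes A$; sequential composition $f;g : A \to C$ of $f : A \to B$ and $g : B \to C$; tensor $f \otimes g : A \otimes C \to B \otimes D$ of $f : A \to B$, $g : C \to D$; evaluation $\mathbf{ev}_{A,B} : (A \multimap B) \otimes A \to B$; and currying $\Lambda_{X,A,B}(h) : X \to (A \multimap B)$ for $h : X \otimes A \to B$. Closed $\Sigma^{+}$-terms are generated by the same rules together with: if $f, g : A \to B$ are closed $\Sigma^{+}$-terms then so is the join $f + g : A \to B$. The $\mathbf{SLat}$-equations are: $+$ is associative, commutative and idempotent (no unit is assumed); $(f+g);h = f;h + g;h$ and $f;(g+h) = f;g + f;h$; $f \otimes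 (g+h) = f\otimes g + f \otimes h$ and $(f+g)\otimes h = f \otimes h + g \otimes h$. -}

module Defs where

open import Data.List using (List; []; _∷_)
open import Data.Product using (_×_; proj₁; proj₂)
open import Data.Nat using (ℕ)
open import Data.Vec using (Vec; []; _∷_)

record Signature : Set₁ where
  field
    Sort : Set
    Op   : Set
    t    : Op → List Sort × List Sort

module Syntax (Σ : Signature) where
  open Signature Σ

  infixr 6 _⊗_
  infixr 5 _⊸_

  data Obj : Set where
    base : Sort → Obj
    I    : Obj
    _⊗_  : Obj → Obj → Obj
    _⊸_  : Obj → Obj → Obj

  ⟦_⟧ : List Sort → Obj
  ⟦ [] ⟧          = I
  ⟦ a ∷ [] ⟧      = base a
  ⟦ a ∷ b ∷ as ⟧  = base a ⊗ ⟦ b ∷ as ⟧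

  infixl 4 _+_
  infixl 5 _⨾_
  infixr 7 _⊗ₘ_

  -- Closed Σ⁺-terms (Σ-terms plus joins).  The coherence isomorphisms
  -- α, λ, ρ of a (non-strict) symmetric monoidal category are included as
  -- structural terms.
  data Term : Obj → Obj → Set where
    op   : (φ : Op) → Term ⟦ proj₁ (t φ) ⟧ ⟦ proj₂ (t φ) ⟧
    id   : (A : Obj) → Term A A
    σ    : (A B : Obj) → Term (A ⊗ B) (B ⊗ A)
    _⨾_  : ∀ {A B C} → Term A B → Term B C → Term A C
    _⊗ₘ_ : ∀ {A B C D} → Term A B → Term C D → Term (A ⊗ C) (B ⊗ D)
    ev   : (A B : Obj) → Term ((A ⊸ B) ⊗ A) B
    Λ    : (X A B : Obj) → Term (X ⊗ A) B → Term X (A ⊸ B)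
    _+_  : ∀ {A B} → Term A B → Term A B → Term A B
    α    : (A B C : Obj) → Term ((A ⊗ B) ⊗ C) (A ⊗ (B ⊗ C))
    α⁻¹  : (A B C : Obj) → Term (A ⊗ (B ⊗ C)) ((A ⊗ B) ⊗ C)
    lu   : (A : Obj) → Term (I ⊗ A) A
    lu⁻¹ : (A : Obj) → Term A (I ⊗ A)
    ru   : (A : Obj) → Term (A ⊗ I) A
    ru⁻¹ : (A : Obj) → Term A (A ⊗ I)

  data JoinFree : ∀ {A B} → Term A B → Set where
    op   : (φ : Op) → JoinFree (op φ)
    id   : (A : Obj) → JoinFree (id A)
    σ    : (A B : Obj) → JoinFree (σ A B)
    _⨾_  : ∀ {A B C} {f : Term A B} {g : Term B C} → JoinFree f → JoinFree g → JoinFree (f ⨾ g)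
    _⊗ₘ_ : ∀ {A B C D} {f : Term A B} {g : Term C D} → JoinFree f → JoinFree g → JoinFree (f ⊗ₘ g)
    ev   : (A B : Obj) → JoinFree (ev A B)
    Λ    : (X A B : Obj) {h : Term (X ⊗ A) B} → JoinFree h → JoinFree (Λ X A B h)
    α    : (A B C : Obj) → JoinFree (α A B C)
    α⁻¹  : (A B C : Obj) → JoinFree (α⁻¹ A B C)
    lu   : (A : Obj) → JoinFree (lu A)
    lu⁻¹ : (A : Obj) → JoinFree (lu⁻¹ A)
    ru   : (A : Obj) → JoinFree (ru A)
    ru⁻¹ : (A : Obj) → JoinFree (ru⁻¹ A)

  infix 3 _≈_

  data _≈_ : ∀ {A B} → Term A B → Term A B → Set where
    ≈-refl  : ∀ {A B} {f : Term A B} → f ≈ f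
    ≈-sym   : ∀ {A B} {f g : Term A B} → f ≈ g → g ≈ f
    ≈-trans : ∀ {A B} {f g h : Term A B} → f ≈ g → g ≈ h → f ≈ h
    ⨾-cong  : ∀ {A B C} {f f' : Term A B} {g g' : Term B C} → f ≈ f' → g ≈ g' → f ⨾ g ≈ f' ⨾ g'
    ⊗-cong  : ∀ {A B C D} {f f' : Term A B} {g g' : Term C D} → f ≈ f' → g ≈ g' → f ⊗ₘ g ≈ f' ⊗ₘ g'
    +-cong  : ∀ {A B} {f f' g g' : Term A B} → f ≈ f' → g ≈ g' → f + g ≈ f' + g'
    Λ-cong  : ∀ {X A B} {h h' : Term (X ⊗ A) B} → h ≈ h' → Λ X A B h ≈ Λ X A B h'
    id-l    : ∀ {A B} {f : Term A B} → id A ⨾ f ≈ f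
    id-r    : ∀ {A B} {f : Term A B} → f ⨾ id B ≈ f
    ⨾-assoc : ∀ {A B C D} {f : Term A B} {g : Term B C} {h : Term C D} → (f ⨾ g) ⨾ h ≈ f ⨾ (g ⨾ h)
    ⊗-id    : ∀ {A B} → id A ⊗ₘ id B ≈ id (A ⊗ B)
    ⊗-comp  : ∀ {A B C D E F} {f : Term A B} {g : Term B C} {h : Term D E} {k : Term E F} →
              (f ⨾ g) ⊗ₘ (h ⨾ k) ≈ (f ⊗ₘ h) ⨾ (g ⊗ₘ k)
    α-iso₁  : ∀ {A B C} → α A B C ⨾ α⁻¹ A B C ≈ id ((A ⊗ B) ⊗ C)
    α-iso₂  : ∀ {A B C} → α⁻¹ A B C ⨾ α A B C ≈ id (A ⊗ (B ⊗ C))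
    lu-iso₁ : ∀ {A} → lu A ⨾ lu⁻¹ A ≈ id (I ⊗ A)
    lu-iso₂ : ∀ {A} → lu⁻¹ A ⨾ lu A ≈ id A
    ru-iso₁ : ∀ {A} → ru A ⨾ ru⁻¹ A ≈ id (A ⊗ I)
    ru-iso₂ : ∀ {A} → ru⁻¹ A ⨾ ru A ≈ id A
    σ-inv   : ∀ {A B} → σ A B ⨾ σ B A ≈ id (A ⊗ B)
    α-nat   : ∀ {A A' B B' C C'} {f : Term A A'} {g : Term B B'} {h : Term C C'} →
              ((f ⊗ₘ g) ⊗ₘ h) ⨾ α A' B' C' ≈ α A B C ⨾ (f ⊗ₘ (g ⊗ₘ h))
    lu-nat  : ∀ {A B} {f : Term A B} → (id I ⊗ₘ f) ⨾ lu B ≈ lu A ⨾ f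
    ru-nat  : ∀ {A B} {f : Term A B} → (f ⊗ₘ id I) ⨾ ru B ≈ ru A ⨾ f
    σ-nat   : ∀ {A A' B B'} {f : Term A A'} {g : Term B B'} →
              (f ⊗ₘ g) ⨾ σ A' B' ≈ σ A B ⨾ (g ⊗ₘ f)
    pentagon : ∀ {A B C D} →
               α (A ⊗ B) C D ⨾ α A B (C ⊗ D)
               ≈ ((α A B C ⊗ₘ id D) ⨾ α A (B ⊗ C) D) ⨾ (id A ⊗ₘ α B C D)
    triangle : ∀ {A B} → α A I B ⨾ (id A ⊗ₘ lu B) ≈ ru A ⊗ₘ id B
    hexagon  : ∀ {A B C} →
               (α A B C ⨾ σ A (B ⊗ C)) ⨾ α B C A
               ≈ ((σ A B ⊗ₘ id C) ⨾ α B A C) ⨾ (id B ⊗ₘ σ A C)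
    +-assoc : ∀ {A B} {f g h : Term A B} → (f + g) + h ≈ f + (g + h)
    +-comm  : ∀ {A B} {f g : Term A B} → f + g ≈ g + f
    +-idem  : ∀ {A B} {f : Term A B} → f + f ≈ f
    ⨾-distʳ : ∀ {A B C} {f g : Term A B} {h : Term B C} → (f + g) ⨾ h ≈ (f ⨾ h) + (g ⨾ h)
    ⨾-distˡ : ∀ {A B C} {f : Term A B} {g h : Term B C} → f ⨾ (g + h) ≈ (f ⨾ g) + (f ⨾ h)
    ⊗-distˡ : ∀ {A B C D} {f : Term A B} {g h : Term C D} → f ⊗ₘ (g + h) ≈ (f ⊗ₘ g) + (f ⊗ₘ h)
    ⊗-distʳ : ∀ {A B C D} {f g : Term A B} {h : Term C D} → (f + g) ⊗ₘ h ≈ (f ⊗ₘ h) + (g ⊗ₘ h)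
    Λ-dist  : ∀ {X A B} {g h : Term (X ⊗ A) B} → Λ X A B (g + h) ≈ Λ X A B g + Λ X A B h

  joins : ∀ {A B n} → Vec (Term A B) (ℕ.suc n) → Term A B
  joins (f ∷ [])     = f
  joins (f ∷ g ∷ fs) = f + joins (g ∷ fs)

-- By the SLat-equations and distributivity of Λ, every term former other
-- than + is additive in each argument, so joins can be pushed outward by
-- structural recursion: a join concatenates two sums of join-free terms,
-- Λ is applied to each summand, and ⨾ or ⊗ to every pair of summands.
module Submission where

open import Defs
open import Data.Nat using (ℕ; suc)
open import Data.Product using (Σ; _×_; _,_)
open import Data.Vec using (Vec; []; _∷_; _++_; map)
open import Data.Vec.Relation.Unary.All using (All; []; _∷_)
open import Data.Vec.Relation.Unary.All.Properties using (++⁺; map⁺)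
import Data.Vec.Relation.Unary.All as All

module JoinNormalForm (Sg : Signature) where
  open Syntax Sg

  record SumOfJoinFree {A B : Obj} (f : Term A B) : Set where
    constructor sumOfJoinFree
    field
      {length-1} : ℕ
      summands   : Vec (Term A B) (suc length-1)
      joinFree   : All JoinFree summands
      f≈joins    : f ≈ joins summands

  Additive : ∀ {A B C D} → (Term A B → Term C D) → Set
  Additive F = ∀ {f g} → F (f + g) ≈ F f + F g

  Congruent : ∀ {A B C D} → (Term A B → Term C D) → Set
  Congruent F = ∀ {f f'} → f ≈ f' → F f ≈ F f'

  PreservesJoinFree : ∀ {A B C D} → (Term A B → Term C D) → Set
  PreservesJoinFree F = ∀ {f} → JoinFree f → JoinFree (F f)

  joins-++ : ∀ {A B m n} (fs : Vec (Term A B) (suc m)) (gs : Vec (Term A B) (suc n)) →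
             joins (fs ++ gs) ≈ joins fs + joins gs
  joins-++ (f ∷ [])     (g ∷ gs) = ≈-refl
  joins-++ (f ∷ f' ∷ fs) (g ∷ gs) =
    ≈-trans (+-cong ≈-refl (joins-++ (f' ∷ fs) (g ∷ gs))) (≈-sym +-assoc)

  joins-map : ∀ {A B C D m} {F : Term A B → Term C D} → Additive F →
              (fs : Vec (Term A B) (suc m)) → joins (map F fs) ≈ F (joins fs)
  joins-map F-additive (f ∷ [])      = ≈-refl
  joins-map F-additive (f ∷ f' ∷ fs) =
    ≈-trans (+-cong ≈-refl (joins-map F-additive (f' ∷ fs))) (≈-sym F-additive)

  sumOfJoinFree-resp-≈ : ∀ {A B} {f g : Term A B} → f ≈ g → SumOfJoinFree f → SumOfJoinFree g
  sumOfJoinFree-resp-≈ f≈g (sumOfJoinFree fs jfs f≈) = sumOfJoinFree fs jfs (≈-trans (≈-sym f≈g) f≈)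

  sumOfJoinFree-singleton : ∀ {A B} {f : Term A B} → JoinFree f → SumOfJoinFree f
  sumOfJoinFree-singleton {f = f} jf = sumOfJoinFree (f ∷ []) (jf ∷ []) ≈-refl

  sumOfJoinFree-+ : ∀ {A B} {f g : Term A B} →
                    SumOfJoinFree f → SumOfJoinFree g → SumOfJoinFree (f + g)
  sumOfJoinFree-+ (sumOfJoinFree fs jfs f≈) (sumOfJoinFree gs jgs g≈) =
    sumOfJoinFree (fs ++ gs) (++⁺ jfs jgs) (≈-trans (+-cong f≈ g≈) (≈-sym (joins-++ fs gs)))

  sumOfJoinFree-map : ∀ {A B C D} {F : Term A B → Term C D} →
                      Congruent F → Additive F → PreservesJoinFree F →
                      ∀ {f} → SumOfJoinFree f → SumOfJoinFree (F f)
  sumOfJoinFree-map {F = F} F-cong F-additive F-joinFree (sumOfJoinFree fs jfs f≈) =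
    sumOfJoinFree (map F fs) (map⁺ (All.map F-joinFree jfs))
      (≈-trans (F-cong f≈) (≈-sym (joins-map F-additive fs)))

  module _ {A B C D E G} (F : Term A B → Term C D → Term E G)
           (F-cong : ∀ {f f' g g'} → f ≈ f' → g ≈ g' → F f g ≈ F f' g')
           (F-additiveˡ : ∀ {f f' g} → F (f + f') g ≈ F f g + F f' g)
           (F-additiveʳ : ∀ {f g g'} → F f (g + g') ≈ F f g + F f g')
           (F-joinFree : ∀ {f g} → JoinFree f → JoinFree g → JoinFree (F f g)) where

    sumOfJoinFree-joinsˡ : ∀ {m g} (fs : Vec (Term A B) (suc m)) → All JoinFree fs →
                           SumOfJoinFree g → SumOfJoinFree (F (joins fs) g)
    sumOfJoinFree-joinsˡ (f ∷ []) (jf ∷ []) sg =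
      sumOfJoinFree-map (F-cong ≈-refl) F-additiveʳ (F-joinFree jf) sg
    sumOfJoinFree-joinsˡ (f ∷ f' ∷ fs) (jf ∷ jfs) sg =
      sumOfJoinFree-resp-≈ (≈-sym F-additiveˡ)
        (sumOfJoinFree-+ (sumOfJoinFree-joinsˡ (f ∷ []) (jf ∷ []) sg)
                         (sumOfJoinFree-joinsˡ (f' ∷ fs) jfs sg))

    sumOfJoinFree-map₂ : ∀ {f g} → SumOfJoinFree f → SumOfJoinFree g → SumOfJoinFree (F f g)
    sumOfJoinFree-map₂ (sumOfJoinFree fs jfs f≈) sg =
      sumOfJoinFree-resp-≈ (F-cong (≈-sym f≈) ≈-refl) (sumOfJoinFree-joinsˡ fs jfs sg)

  toSumOfJoinFree : ∀ {A B} (f : Term A B) → SumOfJoinFree f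
  toSumOfJoinFree (f + g)     = sumOfJoinFree-+ (toSumOfJoinFree f) (toSumOfJoinFree g)
  toSumOfJoinFree (f ⨾ g)     =
    sumOfJoinFree-map₂ _⨾_ ⨾-cong ⨾-distʳ ⨾-distˡ _⨾_ (toSumOfJoinFree f) (toSumOfJoinFree g)
  toSumOfJoinFree (f ⊗ₘ g)    =
    sumOfJoinFree-map₂ _⊗ₘ_ ⊗-cong ⊗-distʳ ⊗-distˡ _⊗ₘ_ (toSumOfJoinFree f) (toSumOfJoinFree g)
  toSumOfJoinFree (Λ X A B h) =
    sumOfJoinFree-map Λ-cong Λ-dist (Λ X A B) (toSumOfJoinFree h)
  toSumOfJoinFree (op φ)      = sumOfJoinFree-singleton (op φ)
  toSumOfJoinFree (id A)      = sumOfJoinFree-singleton (id A)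
  toSumOfJoinFree (σ A B)     = sumOfJoinFree-singleton (σ A B)
  toSumOfJoinFree (ev A B)    = sumOfJoinFree-singleton (ev A B)
  toSumOfJoinFree (α A B C)   = sumOfJoinFree-singleton (α A B C)
  toSumOfJoinFree (α⁻¹ A B C) = sumOfJoinFree-singleton (α⁻¹ A B C)
  toSumOfJoinFree (lu A)      = sumOfJoinFree-singleton (lu A)
  toSumOfJoinFree (lu⁻¹ A)    = sumOfJoinFree-singleton (lu⁻¹ A)
  toSumOfJoinFree (ru A)      = sumOfJoinFree-singleton (ru A)
  toSumOfJoinFree (ru⁻¹ A)    = sumOfJoinFree-singleton (ru⁻¹ A)

lemma1 : (Sg : Signature) → let open Syntax Sg in
    ∀ {A B : Obj} (f : Term A B) →
      Σ ℕ λ m → Σ (Vec (Term A B) (suc m)) λ fs →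
        All JoinFree fs × (f ≈ joins fs)
lemma1 Sg f = _ , summands , joinFree , f≈joins
  where open JoinNormalForm.SumOfJoinFree (JoinNormalForm.toSumOfJoinFree Sg f)
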